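{- During the execution of the Filtered Greedy Strategy (FGS), if a file $f$ satisfies the inequality $$n(f)\Big(l(f)+\sum_{b\in\mathcal{B}_1,\ b<f}s(b)\Big) < s(f)\Big(\sum_{f'<f}n(f')+\sum_{f'\notin\mathcal{F}(\mathcal{B}_1),\ f'>f}n(f')\Big) \qquad (\ast)$$ in the $i$-th iteration (evaluated with the set $\mathcal{B}_1$ current at that iteration), then $f$ also satisfies $(\ast)$ in the $j$-th iteration (evaluated with the set $\mathcal{B}_1$ current at that iteration) for every $j\ge i$.
   Context: Tape model. A single-track tape stores files $f_1,\dots,f_n$ in this order from left to right; positions (blocks) are $1,\dots,m$. File $f$ occupies blocks $l(f),\dots,r(f)$, with $l(f_1)=1$, $l(f_{i+1})=r(f_i)+1$, $r(f_n)=m$; its size is $s(f)=r(f)-l(f)+1\ge 1$. For files write $f<f'$ if $l(f)<l(f')$. A finite set of read requests is given, each associated with one file; $n(f)$ is the number of requests associated with $f$. Mini-batches. A mini-batch is a pair $b=(f,f')$ of files with $l(f)\le l(f')$; $l(b)=l(f)$, $r(b)=r(f')$, $s(b)=r(b)-l(b)+1$, and $\mathcal{F}(b)$ is the set of files $g$ with $l(b)\le l(g)$ and $r(g)\le r(b)$; $b$ is atomic if $f=f'$. For a set $\mathcal{B}_1$ of mini-batches, $\mathcal{F}(\mathcal{B}_1)=\bigcup_{b\in\mathcal{B}_1}\mathcal{F}(b)$, and for $b\in\mathcal{B}_1$ and a file $f$ write $b<f$ if $l(b)<l(f)$. Algorithm FGS. Start with $\mathcal{B}_1=\{(f,f): n(f)>0,\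 f\neq f_1\}$ (the output of the Greedy Strategy). Then, $|\mathcal{F}|$ times ($\mathcal{F}$ the set of files), examine each file $f$ currently in $\mathcal{F}(\mathcal{B}_1)$ and remove the atomic mini-batch $(f,f)$ from $\mathcal{B}_1$ whenever $(\ast)$ holds for the current $\mathcal{B}_1$; each such removal step is an iteration. Return the final $\mathcal{B}_1$. -}

module Defs where

open import Data.Nat using (ℕ; zero; suc; _+_; _*_; _<_; _≤_; _<ᵇ_; _≡ᵇ_)
open import Data.Nat.Properties using (_<?_)
open import Data.Bool using (Bool; true; false; if_then_else_; _∧_; not)
open import Data.Fin using (Fin; toℕ)
open import Data.List using (List; []; _∷_; _++_; map; allFin)
open import Data.Nat.ListAction using (sum)
open import Data.Product using (_×_; _,_)
open import Relation.Nullary using (does)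

-- Files f_1,…,f_n are indexed by Fin n (index k ↦ file f_{k+1}), in tape order.
-- s : sizes, nr : number of requests n(f).
-- A set 𝓑₁ of atomic mini-batches {(g,g)} is represented by its membership
-- predicate on files B : Fin n → Bool (B g = true iff (g,g) ∈ 𝓑₁);
-- then 𝓕(𝓑₁) = {g ∣ B g = true}.
FileSet : ℕ → Set
FileSet n = Fin n → Bool

sumWhere : ∀ {n} → (Fin n → Bool) → (Fin n → ℕ) → ℕ
sumWhere {n} p g = sum (map (λ k → if p k then g k else 0) (allFin n))

_≺_ : ∀ {n} → Fin n → Fin n → Bool
f ≺ f' = toℕ f <ᵇ toℕ f'

lft : ∀ {n} → (Fin n → ℕ) → Fin n → ℕ
lft s f = suc (sumWhere (λ g → g ≺ f) s)

starLHS : ∀ {n} → (s nr : Fin n → ℕ) → FileSet n → Fin n → ℕ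
starLHS s nr B f = nr f * (lft s f + sumWhere (λ g → B g ∧ (g ≺ f)) s)

starRHS : ∀ {n} → (s nr : Fin n → ℕ) → FileSet n → Fin n → ℕ
starRHS s nr B f = s f * (sumWhere (λ g → g ≺ f) nr + sumWhere (λ g → not (B g) ∧ (f ≺ g)) nr)

Star : ∀ {n} → (s nr : Fin n → ℕ) → FileSet n → Fin n → Set
Star s nr B f = starLHS s nr B f < starRHS s nr B f

remove : ∀ {n} → FileSet n → Fin n → FileSet n
remove B f g = if toℕ g ≡ᵇ toℕ f then false else B g

-- Output of the Greedy Strategy: {(f,f) ∣ n(f) > 0, f ≠ f₁}
initialB : ∀ {n} → (nr : Fin n → ℕ) → FileSet n
initialB nr f = (0 <ᵇ nr f) ∧ not (toℕ f ≡ᵇ 0)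

-- Returns the list of sets 𝓑₁ current at
-- each removal step (iteration) of the pass, and the set at the end of the pass.
pass : ∀ {n} → (s nr : Fin n → ℕ) → FileSet n → List (Fin n) → List (FileSet n) × FileSet n
pass s nr B [] = [] , B
pass s nr B (f ∷ fs) with B f ∧ does (starLHS s nr B f <? starRHS s nr B f)
... | true  with pass s nr (remove B f) fs
...   | its , B' = B ∷ its , B'
pass s nr B (f ∷ fs) | false = pass s nr B fs

passes : ∀ {n} → (s nr : Fin n → ℕ) → ℕ → FileSet n → List (FileSet n)
passes s nr zero B = []
passes {n} s nr (suc k) B with pass s nr B (allFin n)
... | its , B' = its ++ passes s nr k B'

-- FGS: |𝓕| = n passes starting from the Greedy Strategy output.
-- The i-th element (0-based) is the set 𝓑₁ current at the (i+1)-th iteration.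
iterationSets : ∀ {n} → (s nr : Fin n → ℕ) → List (FileSet n)
iterationSets {n} s nr = passes s nr n (initialB nr)

-- Removing atomic mini-batches only shrinks 𝓑₁.  Shrinking 𝓑₁ can only
-- decrease the left-hand side of (∗) (fewer batches b < f contribute) and only
-- increase its right-hand side (more files lie outside 𝓕(𝓑₁)), so (∗) is
-- preserved.  Since the sets current at successive iterations of FGS form a
-- descending chain, (∗) persists from iteration i to every later one.
module Submission where

open import Defs
open import Data.Nat using (ℕ; _≤_)
open import Data.Fin using (Fin) renaming (_≤_ to _≤ᶠ_)
open import Data.List using (length; lookup)

open import Data.Bool using (Bool; true; false; if_then_else_; _∧_; not)
open import Data.Fin using (toℕ; zero; suc)
open import Data.List using (List; []; _∷_; _++_; map; allFin)
open import Data.Nat using (zero; suc; _≡ᵇ_; z≤n; s≤s)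
open import Data.Nat.ListAction using (sum)
open import Data.Nat.Properties using (_<?_; ≤-refl; +-mono-≤; +-monoʳ-≤; *-monoʳ-≤; ≤-<-trans; <-≤-trans)
open import Data.Product using (∃; _,_; proj₁; proj₂)
open import Relation.Binary.PropositionalEquality using (_≡_; refl)
open import Relation.Nullary using (does)

infix 4 _⊆ᴮ_

_⊆ᴮ_ : {A : Set} → (A → Bool) → (A → Bool) → Set
p ⊆ᴮ q = ∀ x → p x ≡ true → q x ≡ true

⊆ᴮ-refl : {A : Set} {p : A → Bool} → p ⊆ᴮ p
⊆ᴮ-refl _ e = e

⊆ᴮ-trans : {A : Set} {p q r : A → Bool} → p ⊆ᴮ q → q ⊆ᴮ r → p ⊆ᴮ r
⊆ᴮ-trans p⊆q q⊆r x e = q⊆r x (p⊆q x e)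

∧-⊆ᴮˡ : {A : Set} {p q : A → Bool} (r : A → Bool) →
  p ⊆ᴮ q → (λ x → p x ∧ r x) ⊆ᴮ (λ x → q x ∧ r x)
∧-⊆ᴮˡ {p = p} r p⊆q x e with p x in px
... | true rewrite p⊆q x px = e

not-⊆ᴮ : {A : Set} {p q : A → Bool} → p ⊆ᴮ q → (λ x → not (q x)) ⊆ᴮ (λ x → not (p x))
not-⊆ᴮ {p = p} {q} p⊆q x e with p x in px
... | false = refl
... | true with q x | p⊆q x px
...   | .true | refl = e

sum-if-mono : {A : Set} {p q : A → Bool} (h : A → ℕ) → p ⊆ᴮ q → (xs : List A) →
  sum (map (λ x → if p x then h x else 0) xs) ≤ sum (map (λ x → if q x then h x else 0) xs)
sum-if-mono h p⊆q []       = z≤n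
sum-if-mono {p = p} {q} h p⊆q (x ∷ xs) = +-mono-≤ (if-mono (p x) refl) (sum-if-mono h p⊆q xs)
  where
  if-mono : (b : Bool) → p x ≡ b → (if p x then h x else 0) ≤ (if q x then h x else 0)
  if-mono true  px rewrite px | p⊆q x px = ≤-refl
  if-mono false px rewrite px          = z≤n

sumWhere-mono : ∀ {n} {p q : Fin n → Bool} (h : Fin n → ℕ) → p ⊆ᴮ q →
  sumWhere p h ≤ sumWhere q h
sumWhere-mono {n} h p⊆q = sum-if-mono h p⊆q (allFin n)

module _ {n : ℕ} (s nr : Fin n → ℕ) {B C : FileSet n} (C⊆B : C ⊆ᴮ B) (f : Fin n) where

  starLHS-mono : starLHS s nr C f ≤ starLHS s nr B f
  starLHS-mono = *-monoʳ-≤ (nr f) (+-monoʳ-≤ (lft s f)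
    (sumWhere-mono s (∧-⊆ᴮˡ (λ g → g ≺ f) C⊆B)))

  starRHS-antimono : starRHS s nr B f ≤ starRHS s nr C f
  starRHS-antimono = *-monoʳ-≤ (s f) (+-monoʳ-≤ (sumWhere (λ g → g ≺ f) nr)
    (sumWhere-mono nr (∧-⊆ᴮˡ (λ g → f ≺ g) (not-⊆ᴮ C⊆B))))

  Star-⊆ᴮ : Star s nr B f → Star s nr C f
  Star-⊆ᴮ star = ≤-<-trans starLHS-mono (<-≤-trans star starRHS-antimono)

remove-⊆ᴮ : ∀ {n} (B : FileSet n) (f : Fin n) → remove B f ⊆ᴮ B
remove-⊆ᴮ B f g e with toℕ g ≡ᵇ toℕ f
... | false = e

data Descent {n : ℕ} : FileSet n → List (FileSet n) → FileSet n → Set where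
  done : ∀ {B E} → E ⊆ᴮ B → Descent B [] E
  step : ∀ {B C L E} → C ⊆ᴮ B → Descent C L E → Descent B (C ∷ L) E

Descent-⊆ᴮ : ∀ {n} {A B E : FileSet n} {L} → B ⊆ᴮ A → Descent B L E → Descent A L E
Descent-⊆ᴮ B⊆A (done E⊆B)   = done (⊆ᴮ-trans E⊆B B⊆A)
Descent-⊆ᴮ B⊆A (step C⊆B d) = step (⊆ᴮ-trans C⊆B B⊆A) d

Descent-++ : ∀ {n} {A B E : FileSet n} {L M} → Descent A L B → Descent B M E → Descent A (L ++ M) E
Descent-++ (done B⊆A)   d = Descent-⊆ᴮ B⊆A d
Descent-++ (step C⊆A d) e = step C⊆A (Descent-++ d e)

Descent-head : ∀ {n} {B E : FileSet n} {L} → Descent B L E → (j : Fin (length L)) → lookup L j ⊆ᴮ B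
Descent-head (step C⊆B d) zero    = C⊆B
Descent-head (step C⊆B d) (suc j) = ⊆ᴮ-trans (Descent-head d j) C⊆B

Descent-lookup : ∀ {n} {B E : FileSet n} {L} → Descent B L E →
  {i j : Fin (length L)} → i ≤ᶠ j → lookup L j ⊆ᴮ lookup L i
Descent-lookup (step _ d) {zero}  {zero}  _         = ⊆ᴮ-refl
Descent-lookup (step _ d) {zero}  {suc j} _         = Descent-head d j
Descent-lookup (step _ d) {suc i} {suc j} (s≤s i≤j) = Descent-lookup d i≤j

module _ {n : ℕ} (s nr : Fin n → ℕ) where

  pass-Descent : ∀ B fs → Descent B (proj₁ (pass s nr B fs)) (proj₂ (pass s nr B fs))
  pass-Descent B []       = done ⊆ᴮ-refl
  pass-Descent B (f ∷ fs) with B f ∧ does (starLHS s nr B f <? starRHS s nr B f)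
  ... | true with pass s nr (remove B f) fs | pass-Descent (remove B f) fs
  ...   | _ , _ | d = step ⊆ᴮ-refl (Descent-⊆ᴮ (remove-⊆ᴮ B f) d)
  pass-Descent B (f ∷ fs) | false = pass-Descent B fs

  passes-Descent : ∀ k B → ∃ λ E → Descent B (passes s nr k B) E
  passes-Descent zero    B = B , done ⊆ᴮ-refl
  passes-Descent (suc k) B with pass s nr B (allFin n) | pass-Descent B (allFin n)
  ... | _ , B′ | d with passes-Descent k B′
  ...   | E , d′ = E , Descent-++ d d′

  iterationSets-descending : {i j : Fin (length (iterationSets s nr))} → i ≤ᶠ j →
    lookup (iterationSets s nr) j ⊆ᴮ lookup (iterationSets s nr) i
  iterationSets-descending = Descent-lookup (proj₂ (passes-Descent n (initialB nr)))

lemma1 : (n : ℕ) (s nr : Fin n → ℕ) → (∀ f → 1 ≤ s f) →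
    (f : Fin n) (i j : Fin (length (iterationSets s nr))) → i ≤ᶠ j →
    Star s nr (lookup (iterationSets s nr) i) f →
    Star s nr (lookup (iterationSets s nr) j) f
lemma1 n s nr _ f i j i≤j = Star-⊆ᴮ s nr (iterationSets-descending s nr i≤j) f
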